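{- Let $\tau=(w,x)$ be a pair and $p=(i,j)\in\{1,\dots,n-1\}^2$. Write $p^\to_\tau=(i,j')$. Then $P^\downarrow_\tau(p)$ holds if and only if there exists $i'>i$ such that $p':=(i',j')\in X_\tau$ and $D_w(p,p')=0<D_x(p,p')$. Similarly, writing $p^\leftarrow_\tau=(i,j')$, $P^\uparrow_\tau(p)$ holds if and only if there exists $i'<i$ such that $p':=(i',j')\in X_\tau$ and $D_w(p,p')=0<D_x(p,p')$. In particular, for $p\in X^c_\tau$, $R^\to_\tau(p)$ implies $P^\downarrow_\tau(p)$ and $R^\leftarrow_\tau(p)$ implies $P^\uparrow_\tau(p)$.
   Context: $S_n$ is the symmetric group on $\{1,\dots,n\}$ with Bruhat order $\le$; $\Box=\{0,\dots,n\}^2$. For $w\in S_n$, $\mathrm{rk}_w(i,j)=\#\{u\le i:w(u)\le j\}$ on $\Box$, and $D_w((i,j),(i',j'))=\mathrm{rk}_w(i,j)+\mathrm{rk}_w(i',j')-\mathrm{rk}_w(i,j')-\mathrm{rk}_w(i',j)$. A pair is $\tau=(w,x)$ with $x\le w$; $\mathrm{rk}_\tau=\mathrm{rk}_x-\mathrm{rk}_w$, $X_\tau=\{p\in\Box:\mathrm{rk}_\tau(p)=0\}$, $X^c_\tau=\Box\setminus X_\tau$. For $p=(i,j)\in\Box$, $1\le j\le n-1$: $j^+=\min\{k>j:(i,k)\in X_\tau\}$, $p^\to_\tau=(i,j^+)$, $i^+=\max\{l\ge i:(l,j^+)\in X_\tau,\ D_w(p,(l,j^+))=0\}$, $p^\downarrow_\tau=(i^+,j)$;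 $j^-=\max\{k<j:(i,k)\in X_\tau\}$, $p^\leftarrow_\tau=(i,j^-)$, $i^-=\min\{l\le i:(l,j^-)\in X_\tau,\ D_w(p,(l,j^-))=0\}$, $p^\uparrow_\tau=(i^-,j)$. $P^\downarrow_\tau(p)$ means $\mathrm{rk}_\tau(p^\downarrow_\tau)<\mathrm{rk}_\tau(p)$ and $P^\uparrow_\tau(p)$ means $\mathrm{rk}_\tau(p^\uparrow_\tau)<\mathrm{rk}_\tau(p)$. For $p=(i,j)\in X^c_\tau$: $p^+_\tau=(\min\{l>i:(l,j)\in X_\tau\},\min\{l>j:(i,l)\in X_\tau\})$, $p^-_\tau=(\max\{l<i:(l,j)\in X_\tau\},\max\{l<j:(i,l)\in X_\tau\})$; $R^\to_\tau(p)$ means $D_x(p,p^+_\tau)=1$ and $R^\leftarrow_\tau(p)$ means $D_x(p,p^-_\tau)=1$. -}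

module Defs where

open import Data.Nat using (ℕ; zero; suc; _≤_; _<_; _∸_; _<?_)
open import Data.Nat as ℕ using ()
open import Data.Fin using (Fin; toℕ)
open import Data.Fin.Permutation using (Permutation′; _⟨$⟩ʳ_; transpose)
open import Data.List using (length; filter; allFin)
open import Data.Integer using (ℤ; +_; _+_; _-_; _≟_)
open import Data.Product using (Σ; _×_; _,_; proj₁; proj₂)
open import Data.Sum using (_⊎_)
open import Data.Bool using (Bool; true; false; if_then_else_; not)
open import Relation.Nullary using (does)
open import Relation.Nullary.Decidable using (_×-dec_)
open import Relation.Binary.PropositionalEquality using (_≡_)
open import Relation.Binary.Construct.Closure.ReflexiveTransitive using (Star)

-- Permutations of {1..n}, encoded 0-indexed as permutations of Fin n.
Perm : ℕ → Set
Perm n = Permutation′ n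

-- Bruhat order: reflexive-transitive closure of  x → x·t_{ab}  with a < b and
-- x(a) < x(b) (i.e. the length goes up), modulo pointwise equality of permutations.
PwEq : ∀ {n} → Perm n → Perm n → Set
PwEq x y = ∀ u → x ⟨$⟩ʳ u ≡ y ⟨$⟩ʳ u

BruhatStep : ∀ {n} → Perm n → Perm n → Set
BruhatStep {n} x y =
  Σ (Fin n) λ a → Σ (Fin n) λ b →
    (toℕ a < toℕ b) × (toℕ (x ⟨$⟩ʳ a) < toℕ (x ⟨$⟩ʳ b)) ×
    (∀ u → y ⟨$⟩ʳ u ≡ x ⟨$⟩ʳ (transpose a b ⟨$⟩ʳ u))

_≤B_ : ∀ {n} → Perm n → Perm n → Set
x ≤B y = Star (λ a b → PwEq a b ⊎ BruhatStep a b) x y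

Pt : Set
Pt = ℕ × ℕ

-- rk_w(i,j) = #{u ≤ i : w(u) ≤ j}  (1-indexed u; here u : Fin n with toℕ u + 1)
rkℕ : ∀ {n} → Perm n → ℕ → ℕ → ℕ
rkℕ {n} w i j = length (filter (λ u → (toℕ u <? i) ×-dec (toℕ (w ⟨$⟩ʳ u) <? j)) (allFin n))

rk : ∀ {n} → Perm n → Pt → ℤ
rk w (i , j) = + rkℕ w i j

D : ∀ {n} → Perm n → Pt → Pt → ℤ
D w (i , j) (i' , j') = (rk w (i , j) + rk w (i' , j')) - (rk w (i , j') + rk w (i' , j))

record Pair (n : ℕ) : Set where
  constructor pair
  field
    w : Perm n
    x : Perm n
    x≤w : x ≤B w
open Pair public

rkτ : ∀ {n} → Pair n → Pt → ℤ
rkτ τ p = rk (x τ) p - rk (w τ) p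

inBox : ℕ → Pt → Set
inBox n (i , j) = (i ≤ n) × (j ≤ n)

InX : ∀ {n} → Pair n → Pt → Set
InX {n} τ p = inBox n p × (rkτ τ p ≡ + 0)

isX : ∀ {n} → Pair n → Pt → Bool
isX τ p = does (rkτ τ p ≟ + 0)

isZero : ℤ → Bool
isZero z = does (z ≟ + 0)

-- smallest k in [lo, lo + f] with P k ; default lo + f
minUp : (ℕ → Bool) → ℕ → ℕ → ℕ
minUp P lo zero = lo
minUp P lo (suc f) = if P lo then lo else minUp P (suc lo) f

-- largest k in [lo, lo + f] with P k ; default lo
maxDown : (ℕ → Bool) → ℕ → ℕ → ℕ
maxDown P lo zero = lo
maxDown P lo (suc f) = if P (lo ℕ.+ suc f) then lo ℕ.+ suc f else maxDown P lo f

-- j⁺ = min{k > j : (i,k) ∈ X_τ}   (searched in [j+1, n]; (i,n) ∈ X_τ always)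
jPlus : ∀ {n} → Pair n → Pt → ℕ
jPlus {n} τ (i , j) = minUp (λ k → isX τ (i , k)) (suc j) (n ∸ suc j)

-- j⁻ = max{k < j : (i,k) ∈ X_τ}   (searched in [0, j-1]; (i,0) ∈ X_τ always)
jMinus : ∀ {n} → Pair n → Pt → ℕ
jMinus τ (i , j) = maxDown (λ k → isX τ (i , k)) 0 (j ∸ 1)

right : ∀ {n} → Pair n → Pt → Pt
right τ (i , j) = (i , jPlus τ (i , j))

left : ∀ {n} → Pair n → Pt → Pt
left τ (i , j) = (i , jMinus τ (i , j))

-- i⁺ = max{l ≥ i : (l,j⁺) ∈ X_τ, D_w(p,(l,j⁺)) = 0}   (searched in [i, n])
iPlus : ∀ {n} → Pair n → Pt → ℕ
iPlus {n} τ p@(i , j) =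
  let j' = jPlus τ p in
  maxDown (λ l → isX τ (l , j') Data.Bool.∧ isZero (D (w τ) p (l , j'))) i (n ∸ i)

-- i⁻ = min{l ≤ i : (l,j⁻) ∈ X_τ, D_w(p,(l,j⁻)) = 0}   (searched in [0, i])
iMinus : ∀ {n} → Pair n → Pt → ℕ
iMinus τ p@(i , j) =
  let j' = jMinus τ p in
  minUp (λ l → isX τ (l , j') Data.Bool.∧ isZero (D (w τ) p (l , j'))) 0 i

down : ∀ {n} → Pair n → Pt → Pt
down τ p@(i , j) = (iPlus τ p , j)

up : ∀ {n} → Pair n → Pt → Pt
up τ p@(i , j) = (iMinus τ p , j)

Pdown : ∀ {n} → Pair n → Pt → Set
Pdown τ p = rkτ τ (down τ p) Data.Integer.< rkτ τ p

Pup : ∀ {n} → Pair n → Pt → Set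
Pup τ p = rkτ τ (up τ p) Data.Integer.< rkτ τ p

-- p⁺_τ = (min{l > i : (l,j) ∈ X_τ}, min{l > j : (i,l) ∈ X_τ})
plusPt : ∀ {n} → Pair n → Pt → Pt
plusPt {n} τ (i , j) =
  ( minUp (λ l → isX τ (l , j)) (suc i) (n ∸ suc i)
  , minUp (λ l → isX τ (i , l)) (suc j) (n ∸ suc j) )

-- p⁻_τ = (max{l < i : (l,j) ∈ X_τ}, max{l < j : (i,l) ∈ X_τ})
minusPt : ∀ {n} → Pair n → Pt → Pt
minusPt τ (i , j) =
  ( maxDown (λ l → isX τ (l , j)) 0 (i ∸ 1)
  , maxDown (λ l → isX τ (i , l)) 0 (j ∸ 1) )

Rright : ∀ {n} → Pair n → Pt → Set
Rright τ p = D (x τ) p (plusPt τ p) ≡ + 1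

Rleft : ∀ {n} → Pair n → Pt → Set
Rleft τ p = D (x τ) p (minusPt τ p) ≡ + 1

module Submission where

-- Everything rests on one algebraic observation.  Writing
--   Δf(q , r) = f(q) + f(r) − f(q₁ , r₂) − f(r₁ , q₂)
-- for the mixed second difference of a grid function f, we have D_v = Δ rk_v, hence
--   D_x = D_w + Δ rk_τ .
-- When two corners of the rectangle spanned by q and r lie in X_τ (where rk_τ vanishes),
-- Δ rk_τ collapses to a difference or a sum of the two remaining values of rk_τ.

open import Defs
open import Data.Nat using (ℕ; _≤_; _<_; _∸_)
open import Data.Integer using (+_) renaming (_<_ to _<ℤ_)
open import Data.Product using (Σ; _×_; _,_; proj₂)
open import Function.Bundles using (_⇔_)
open import Relation.Binary.PropositionalEquality using (_≡_; _≢_)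

open import Data.Nat using (zero; suc; z≤n; s≤s; _<?_; _≤?_)
import Data.Nat.Properties as ℕP
open import Data.Integer using (ℤ; +≤+; +<+) renaming (_≤_ to _≤ℤ_)
import Data.Integer.Properties as ℤP
open import Data.Integer.Tactic.RingSolver using (solve-∀)
open import Data.Bool using (Bool; true; false; _∧_)
open import Data.Bool.Properties using (∧-identityʳ; ∧-zeroʳ)
open import Data.Fin using (Fin; toℕ)
import Data.Fin as F
open import Data.Fin.Properties using (_≟_; toℕ<n)
open import Data.Fin.Permutation using (_⟨$⟩ʳ_; transpose)
open import Data.List using (length; filter; tabulate)
open import Data.Product using (proj₁)
open import Data.Sum using (_⊎_; inj₁; inj₂; [_,_]; map₁; map₂)
open import Data.Empty using (⊥-elim)
open import Function using (_∘_)
open import Relation.Nullary using (Dec; yes; no; does)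
open import Relation.Nullary.Decidable using (dec-true)
open import Relation.Unary using (Decidable)
open import Relation.Binary.PropositionalEquality using (refl; sym; trans; cong; cong₂; subst; subst₂; module ≡-Reasoning)
open import Relation.Binary.Construct.Closure.ReflexiveTransitive using (ε; _◅_)
open import Function.Bundles using (mk⇔; Equivalence)
open import Algebra.Properties.CommutativeMonoid.Sum ℕP.+-0-commutativeMonoid
  using (sum; ∑-distrib-+; sum-permute; sum-cong-≗; sum-replicate-zero)

does-sound : ∀ {P : Set} (d : Dec P) → does d ≡ true → P
does-sound (yes p) _ = p
does-sound (no _) ()

∧-true : ∀ {a b : Bool} → a ∧ b ≡ true → a ≡ true × b ≡ true
∧-true {true} e = refl , e

module Search where
  open import Data.Nat using (_+_)

  minUp-lower : ∀ P lo f → lo ≤ minUp P lo f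
  minUp-lower P lo zero = ℕP.≤-refl
  minUp-lower P lo (suc f) with P lo
  ... | true = ℕP.≤-refl
  ... | false = ℕP.<⇒≤ (minUp-lower P (suc lo) f)

  minUp-upper : ∀ P lo f → minUp P lo f ≤ lo + f
  minUp-upper P lo zero = ℕP.m≤m+n lo 0
  minUp-upper P lo (suc f) with P lo
  ... | true = ℕP.m≤m+n lo (suc f)
  ... | false = subst (minUp P (suc lo) f ≤_) (sym (ℕP.+-suc lo f)) (minUp-upper P (suc lo) f)

  minUp-found : ∀ P lo f → P (minUp P lo f) ≡ true ⊎ minUp P lo f ≡ lo + f
  minUp-found P lo zero = inj₂ (sym (ℕP.+-identityʳ lo))
  minUp-found P lo (suc f) with P lo in eq
  ... | true = inj₁ eq
  ... | false with minUp-found P (suc lo) f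
  ...   | inj₁ e = inj₁ e
  ...   | inj₂ e = inj₂ (trans e (sym (ℕP.+-suc lo f)))

  minUp-least : ∀ P lo f k → lo ≤ k → P k ≡ true → minUp P lo f ≤ k
  minUp-least P lo zero k lo≤k _ = lo≤k
  minUp-least P lo (suc f) k lo≤k Pk with P lo in eq
  ... | true = lo≤k
  ... | false with ℕP.m≤n⇒m<n∨m≡n lo≤k
  ...   | inj₁ lo<k = minUp-least P (suc lo) f k lo<k Pk
  ...   | inj₂ refl with trans (sym eq) Pk
  ...     | ()

  maxDown-lower : ∀ P lo f → lo ≤ maxDown P lo f
  maxDown-lower P lo zero = ℕP.≤-refl
  maxDown-lower P lo (suc f) with P (lo + suc f)
  ... | true = ℕP.m≤m+n lo (suc f)
  ... | false = maxDown-lower P lo f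

  maxDown-upper : ∀ P lo f → maxDown P lo f ≤ lo + f
  maxDown-upper P lo zero = ℕP.m≤m+n lo 0
  maxDown-upper P lo (suc f) with P (lo + suc f)
  ... | true = ℕP.≤-refl
  ... | false = ℕP.≤-trans (maxDown-upper P lo f) (ℕP.+-monoʳ-≤ lo (ℕP.n≤1+n f))

  maxDown-found : ∀ P lo f → P (maxDown P lo f) ≡ true ⊎ maxDown P lo f ≡ lo
  maxDown-found P lo zero = inj₂ refl
  maxDown-found P lo (suc f) with P (lo + suc f) in eq
  ... | true = inj₁ eq
  ... | false = maxDown-found P lo f

  maxDown-greatest : ∀ P lo f k → k ≤ lo + f → P k ≡ true → k ≤ maxDown P lo f
  maxDown-greatest P lo zero k k≤ _ = subst (k ≤_) (ℕP.+-identityʳ lo) k≤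
  maxDown-greatest P lo (suc f) k k≤ Pk with P (lo + suc f) in eq
  ... | true = k≤
  ... | false with ℕP.m≤n⇒m<n∨m≡n k≤
  ...   | inj₁ k< = maxDown-greatest P lo f k (ℕP.≤-pred (subst (suc k ≤_) (ℕP.+-suc lo f) k<)) Pk
  ...   | inj₂ refl with trans (sym eq) Pk
  ...     | ()

open Search

module Ranks where
  open import Data.Nat using (_+_)

  indicator : Bool → ℕ
  indicator true = 1
  indicator false = 0

  inQuadrant : ℕ → ℕ → ℕ → ℕ → Bool
  inQuadrant a b u v = does (u <? a) ∧ does (v <? b)

  cell : ∀ {n} → Perm n → ℕ → ℕ → Fin n → ℕ
  cell w a b u = indicator (inQuadrant a b (toℕ u) (toℕ (w ⟨$⟩ʳ u)))

  <?-true : ∀ {u a} → u < a → does (u <? a) ≡ true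
  <?-true {u} {a} = dec-true (u <? a)

  count-tabulate : ∀ {A : Set} {P : A → Set} (P? : Decidable P) n (f : Fin n → A) →
    length (filter P? (tabulate f)) ≡ sum (λ u → indicator (does (P? (f u))))
  count-tabulate P? zero f = refl
  count-tabulate P? (suc n) f with does (P? (f F.zero))
  ... | true = cong suc (count-tabulate P? n (f ∘ F.suc))
  ... | false = count-tabulate P? n (f ∘ F.suc)

  rank-as-sum : ∀ {n} (w : Perm n) a b → rkℕ w a b ≡ sum (cell w a b)
  rank-as-sum {n} w a b = count-tabulate _ n (λ u → u)

  rank-image : ∀ {n} (y : Perm n) (g : Fin n → Fin n) → (∀ u → y ⟨$⟩ʳ u ≡ g u) →
    ∀ a b → rkℕ y a b ≡ sum (λ u → indicator (inQuadrant a b (toℕ u) (toℕ (g u))))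
  rank-image y g y≗g a b = trans (rank-as-sum y a b)
    (sum-cong-≗ (λ u → cong (λ v → indicator (inQuadrant a b (toℕ u) (toℕ v))) (y≗g u)))

  ranks-as-sum : ∀ {n} (w : Perm n) a b c d →
    rkℕ w a b + rkℕ w c d ≡ sum (λ u → cell w a b u + cell w c d u)
  ranks-as-sum w a b c d = begin
    rkℕ w a b + rkℕ w c d             ≡⟨ cong₂ _+_ (rank-as-sum w a b) (rank-as-sum w c d) ⟩
    sum (cell w a b) + sum (cell w c d) ≡⟨ ∑-distrib-+ (cell w a b) (cell w c d) ⟨
    sum (λ u → cell w a b u + cell w c d u) ∎
    where open ≡-Reasoning

  sum-mono : ∀ {n} {f g : Fin n → ℕ} → (∀ u → f u ≤ g u) → sum f ≤ sum g
  sum-mono {zero} _ = z≤n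
  sum-mono {suc n} f≤g = ℕP.+-mono-≤ (f≤g F.zero) (sum-mono (f≤g ∘ F.suc))

  half-≤ : ∀ {a b} → a + a ≤ b + b → a ≤ b
  half-≤ {a} {b} 2a≤2b with a ≤? b
  ... | yes a≤b = a≤b
  ... | no a≰b = ⊥-elim (ℕP.<⇒≱ (ℕP.+-mono-< b<a b<a) 2a≤2b)
    where b<a = ℕP.≰⇒> a≰b

  -- Symmetrisation: comparing f and g on every orbit {u , t u} of a permutation t
  -- suffices to compare their sums, since Σ f = Σ (f ∘ t).
  sum-symmetrise : ∀ {n} (t : Perm n) {f g : Fin n → ℕ} →
    (∀ u → f u + f (t ⟨$⟩ʳ u) ≤ g u + g (t ⟨$⟩ʳ u)) → sum f ≤ sum g
  sum-symmetrise t {f} {g} orbit≤ = half-≤ (begin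
    sum f + sum f                            ≡⟨ cong (λ s → sum f + s) (sum-permute f t) ⟩
    sum f + sum (f ∘ (t ⟨$⟩ʳ_))              ≡⟨ ∑-distrib-+ f _ ⟨
    sum (λ u → f u + f (t ⟨$⟩ʳ u))           ≤⟨ sum-mono orbit≤ ⟩
    sum (λ u → g u + g (t ⟨$⟩ʳ u))           ≡⟨ ∑-distrib-+ g _ ⟩
    sum g + sum (g ∘ (t ⟨$⟩ʳ_))              ≡⟨ cong (λ s → sum g + s) (sum-permute g t) ⟨
    sum g + sum g                            ∎)
    where open ℕP.≤-Reasoning

  -- Rearrangement inequality for indicators: if p' ⇒ p and q' ⇒ q then
  -- (p − p')(q − q') ≥ 0, i.e.  [p' q] + [p q'] ≤ [p' q'] + [p q].
  exchange : ∀ {p p' q q' : Bool} → (p' ≡ true → p ≡ true) → (q' ≡ true → q ≡ true) →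
    indicator (p' ∧ q) + indicator (p ∧ q') ≤ indicator (p' ∧ q') + indicator (p ∧ q)
  exchange {true} {true} {q} {q'} _ _ = ℕP.≤-reflexive (ℕP.+-comm (indicator q) (indicator q'))
  exchange {false} {true} p'⇒p _ with p'⇒p refl
  ... | ()
  exchange {true} {false} {true} {true} _ _ = ℕP.≤-refl
  exchange {true} {false} {true} {false} _ _ = z≤n
  exchange {true} {false} {false} {true} _ q'⇒q with q'⇒q refl
  ... | ()
  exchange {true} {false} {false} {false} _ _ = z≤n
  exchange {false} {false} _ _ = z≤n

  quadrant-rectangle : ∀ {a b c d} u v → a ≤ b → c ≤ d →
    indicator (inQuadrant a d u v) + indicator (inQuadrant b c u v)
      ≤ indicator (inQuadrant a c u v) + indicator (inQuadrant b d u v)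
  quadrant-rectangle {a} {b} {c} {d} u v a≤b c≤d = exchange
    (λ e → <?-true (ℕP.<-≤-trans (does-sound (u <? a) e) a≤b))
    (λ e → <?-true (ℕP.<-≤-trans (does-sound (v <? c) e) c≤d))

  quadrant-exchange : ∀ {a b u u' v v'} → u ≤ u' → v ≤ v' →
    indicator (inQuadrant a b u' v) + indicator (inQuadrant a b u v')
      ≤ indicator (inQuadrant a b u' v') + indicator (inQuadrant a b u v)
  quadrant-exchange {a} {b} {u' = u'} {v' = v'} u≤u' v≤v' = exchange
    (λ e → <?-true (ℕP.≤-<-trans u≤u' (does-sound (u' <? a) e)))
    (λ e → <?-true (ℕP.≤-<-trans v≤v' (does-sound (v' <? b) e)))

  rank-rectangle : ∀ {n} (w : Perm n) {a b c d} → a ≤ b → c ≤ d →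
    rkℕ w a d + rkℕ w b c ≤ rkℕ w a c + rkℕ w b d
  rank-rectangle w {a} {b} {c} {d} a≤b c≤d =
    subst₂ _≤_ (sym (ranks-as-sum w a d b c)) (sym (ranks-as-sum w a c b d))
      (sum-mono (λ u → quadrant-rectangle (toℕ u) (toℕ (w ⟨$⟩ʳ u)) a≤b c≤d))

  rank-row-zero : ∀ {n} (w : Perm n) b → rkℕ w 0 b ≡ 0
  rank-row-zero {n} w b = trans (rank-as-sum w 0 b) (sum-replicate-zero n)

  rank-column-zero : ∀ {n} (w : Perm n) a → rkℕ w a 0 ≡ 0
  rank-column-zero {n} w a = begin
    rkℕ w a 0        ≡⟨ rank-as-sum w a 0 ⟩
    sum (cell w a 0) ≡⟨ sum-cong-≗ {n} (λ u → cong indicator (∧-zeroʳ (does (toℕ u <? a)))) ⟩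
    sum {n} (λ _ → 0) ≡⟨ sum-replicate-zero n ⟩
    0                ∎
    where open ≡-Reasoning

  rank-column-full : ∀ {n} (v w : Perm n) a → rkℕ v a n ≡ rkℕ w a n
  rank-column-full {n} v w a = begin
    rkℕ v a n        ≡⟨ rank-as-sum v a n ⟩
    sum (cell v a n) ≡⟨ sum-cong-≗ {n} (λ u → trans (full v u) (sym (full w u))) ⟩
    sum (cell w a n) ≡⟨ rank-as-sum w a n ⟨
    rkℕ w a n        ∎
    where
    open ≡-Reasoning
    full : ∀ w′ u → cell w′ a n u ≡ indicator (does (toℕ u <? a))
    full w′ u = trans (cong (λ b → indicator (does (toℕ u <? a) ∧ b)) (<?-true (toℕ<n (w′ ⟨$⟩ʳ u))))
                      (cong indicator (∧-identityʳ _))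

  quadrant-full-row : ∀ {a b u} v → u < a → inQuadrant a b u v ≡ does (v <? b)
  quadrant-full-row {b = b} v u<a = cong (_∧ does (v <? b)) (<?-true u<a)

  module _ {n} {a b : Fin n} (a≢b : a ≢ b) where
    transpose-left : transpose a b ⟨$⟩ʳ a ≡ b
    transpose-left with a ≟ a
    ... | yes _ = refl
    ... | no a≢a = ⊥-elim (a≢a refl)

    transpose-right : transpose a b ⟨$⟩ʳ b ≡ a
    transpose-right with b ≟ a
    ... | yes b≡a = ⊥-elim (a≢b (sym b≡a))
    ... | no _ with b ≟ b
    ...   | yes _ = refl
    ...   | no b≢b = ⊥-elim (b≢b refl)

    transpose-other : ∀ u → u ≢ a → u ≢ b → transpose a b ⟨$⟩ʳ u ≡ u
    transpose-other u u≢a u≢b with u ≟ a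
    ... | yes u≡a = ⊥-elim (u≢a u≡a)
    ... | no _ with u ≟ b
    ...   | yes u≡b = ⊥-elim (u≢b u≡b)
    ...   | no _ = refl

  record RankBelow {n} (y x : Perm n) : Set where
    field
      rank-≤ : ∀ a b → rkℕ y a b ≤ rkℕ x a b
      last-row-≡ : ∀ b → rkℕ y n b ≡ rkℕ x n b
  open RankBelow public

  rank-below-refl : ∀ {n} {x : Perm n} → RankBelow x x
  rank-below-refl = record { rank-≤ = λ _ _ → ℕP.≤-refl ; last-row-≡ = λ _ → refl }

  rank-below-trans : ∀ {n} {x y z : Perm n} → RankBelow z y → RankBelow y x → RankBelow z x
  rank-below-trans z≤y y≤x = record
    { rank-≤ = λ a b → ℕP.≤-trans (rank-≤ z≤y a b) (rank-≤ y≤x a b)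
    ; last-row-≡ = λ b → trans (last-row-≡ z≤y b) (last-row-≡ y≤x b) }

  rank-pointwise : ∀ {n} {x y : Perm n} → PwEq x y → RankBelow y x
  rank-pointwise {n} {x} {y} x≗y = record { rank-≤ = λ a b → ℕP.≤-reflexive (same a b) ; last-row-≡ = same n }
    where
    same : ∀ a b → rkℕ y a b ≡ rkℕ x a b
    same a b = trans (rank-image y (x ⟨$⟩ʳ_) (sym ∘ x≗y) a b) (sym (rank-as-sum x a b))

  -- On the orbit
  -- {a , b} this is quadrant-exchange; elsewhere the cells of x and y agree, so
  -- symmetrisation over t_ab gives rk_y ≤ rk_x.  On the last row every u is counted,
  -- so rk_y(n , j) is a rearrangement of the sum defining rk_x(n , j).
  bruhat-step-rank : ∀ {n} {x y : Perm n} → BruhatStep x y → RankBelow y x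
  bruhat-step-rank {n} {x} {y} (a , b , a<b , xa<xb , y≗xt) = record { rank-≤ = below ; last-row-≡ = last-row }
    where
    a≢b : a ≢ b
    a≢b a≡b = ℕP.<-irrefl (cong toℕ a≡b) a<b

    cellAt : ℕ → ℕ → Fin n → Fin n → ℕ
    cellAt i j u v = indicator (inQuadrant i j (toℕ u) (toℕ (x ⟨$⟩ʳ v)))

    moved : ℕ → ℕ → Fin n → ℕ
    moved i j u = cellAt i j u (transpose a b ⟨$⟩ʳ u)

    rank-y : ∀ i j → rkℕ y i j ≡ sum (moved i j)
    rank-y = rank-image y (λ u → x ⟨$⟩ʳ (transpose a b ⟨$⟩ʳ u)) y≗xt

    t² : ∀ u {v} → transpose a b ⟨$⟩ʳ u ≡ v → transpose a b ⟨$⟩ʳ (transpose a b ⟨$⟩ʳ u) ≡ transpose a b ⟨$⟩ʳ v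
    t² u = cong (transpose a b ⟨$⟩ʳ_)

    orbit-a : ∀ i j {v v'} → v ≡ b → v' ≡ a → cellAt i j a v + cellAt i j v v' ≤ cellAt i j a a + cellAt i j v v
    orbit-a i j refl refl =
      subst₂ _≤_ (ℕP.+-comm (cellAt i j b a) (cellAt i j a b)) (ℕP.+-comm (cellAt i j b b) (cellAt i j a a))
        (quadrant-exchange {i} {j} (ℕP.<⇒≤ a<b) (ℕP.<⇒≤ xa<xb))

    orbit-b : ∀ i j {v v'} → v ≡ a → v' ≡ b → cellAt i j b v + cellAt i j v v' ≤ cellAt i j b b + cellAt i j v v
    orbit-b i j refl refl = quadrant-exchange {i} {j} (ℕP.<⇒≤ a<b) (ℕP.<⇒≤ xa<xb)

    orbit-fixed : ∀ i j u {v v'} → v ≡ u → v' ≡ u → cellAt i j u v + cellAt i j v v' ≤ cellAt i j u u + cellAt i j v v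
    orbit-fixed i j u refl refl = ℕP.≤-refl

    orbit : ∀ i j u → moved i j u + moved i j (transpose a b ⟨$⟩ʳ u)
                        ≤ cell x i j u + cell x i j (transpose a b ⟨$⟩ʳ u)
    orbit i j u = by-cases (u ≟ a) (u ≟ b)
      where
      t-u = transpose a b ⟨$⟩ʳ u
      by-cases : Dec (u ≡ a) → Dec (u ≡ b) → moved i j u + moved i j t-u ≤ cell x i j u + cell x i j t-u
      by-cases (yes refl) _ = orbit-a i j (transpose-left a≢b) (trans (t² a (transpose-left a≢b)) (transpose-right a≢b))
      by-cases (no _) (yes refl) = orbit-b i j (transpose-right a≢b) (trans (t² b (transpose-right a≢b)) (transpose-left a≢b))
      by-cases (no u≢a) (no u≢b) = orbit-fixed i j u fixed (trans (t² u fixed) fixed)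
        where fixed = transpose-other a≢b u u≢a u≢b

    below : ∀ i j → rkℕ y i j ≤ rkℕ x i j
    below i j = subst₂ _≤_ (sym (rank-y i j)) (sym (rank-as-sum x i j))
      (sum-symmetrise (transpose a b) (orbit i j))

    last-row : ∀ j → rkℕ y n j ≡ rkℕ x n j
    last-row j = begin
      rkℕ y n j                                ≡⟨ rank-y n j ⟩
      sum (moved n j)                          ≡⟨ sum-cong-≗ {n} row ⟩
      sum (cell x n j ∘ (transpose a b ⟨$⟩ʳ_)) ≡⟨ sum-permute (cell x n j) (transpose a b) ⟨
      sum (cell x n j)                         ≡⟨ rank-as-sum x n j ⟨
      rkℕ x n j                                ∎
      where
      open ≡-Reasoning
      row : ∀ u → moved n j u ≡ cell x n j (transpose a b ⟨$⟩ʳ u)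
      row u = let t·u = transpose a b ⟨$⟩ʳ u in
        trans (cong indicator (quadrant-full-row {b = j} (toℕ (x ⟨$⟩ʳ t·u)) (toℕ<n u)))
              (sym (cong indicator (quadrant-full-row {b = j} (toℕ (x ⟨$⟩ʳ t·u)) (toℕ<n t·u))))

  bruhat-rank : ∀ {n} {x y : Perm n} → x ≤B y → RankBelow y x
  bruhat-rank ε = rank-below-refl
  bruhat-rank (inj₁ x≗z ◅ z≤y) = rank-below-trans (bruhat-rank z≤y) (rank-pointwise x≗z)
  bruhat-rank (inj₂ step ◅ z≤y) = rank-below-trans (bruhat-rank z≤y) (bruhat-step-rank step)

open Ranks

module MixedDifference where
  open import Data.Integer using (_+_; _-_; -_)

  Δ : (Pt → ℤ) → Pt → Pt → ℤ
  Δ f (i , j) (i' , j') = (f (i , j) + f (i' , j')) - (f (i , j') + f (i' , j))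

  Δ-split : ∀ f g q r → Δ f q r ≡ Δ g q r + Δ (λ s → f s - g s) q r
  Δ-split f g (a , b) (c , d) = identity (f (a , b)) (f (c , d)) (f (a , d)) (f (c , b))
                                         (g (a , b)) (g (c , d)) (g (a , d)) (g (c , b))
    where
    identity : ∀ f₁ f₂ f₃ f₄ g₁ g₂ g₃ g₄ → (f₁ + f₂) - (f₃ + f₄)
      ≡ ((g₁ + g₂) - (g₃ + g₄)) + (((f₁ - g₁) + (f₂ - g₂)) - ((f₃ - g₃) + (f₄ - g₄)))
    identity = solve-∀

  Δ-rows : ∀ f i l I j c → Δ f (i , j) (I , c) ≡ Δ f (i , j) (l , c) + Δ f (l , j) (I , c)
  Δ-rows f i l I j c = identity (f (i , j)) (f (I , c)) (f (i , c)) (f (I , j)) (f (l , c)) (f (l , j))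
    where
    identity : ∀ a b c′ d e g → (a + b) - (c′ + d) ≡ ((a + e) - (c′ + g)) + ((g + b) - (e + d))
    identity = solve-∀

  Δ-sym : ∀ f q r → Δ f q r ≡ Δ f r q
  Δ-sym f (a , b) (c , d) = identity (f (a , b)) (f (c , d)) (f (a , d)) (f (c , b))
    where
    identity : ∀ x y z t → (x + y) - (z + t) ≡ (y + x) - (t + z)
    identity = solve-∀

  Δ-vanishing-column : ∀ f a b c d → f (a , d) ≡ + 0 → f (c , d) ≡ + 0 →
    Δ f (a , b) (c , d) ≡ f (a , b) - f (c , b)
  Δ-vanishing-column f a b c d ad≡0 cd≡0 rewrite ad≡0 | cd≡0 = identity (f (a , b)) (f (c , b))
    where
    identity : ∀ x y → (x + + 0) - (+ 0 + y) ≡ x - y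
    identity = solve-∀

  Δ-vanishing-antidiagonal : ∀ f a b c d → f (a , d) ≡ + 0 → f (c , b) ≡ + 0 →
    Δ f (a , b) (c , d) ≡ f (a , b) + f (c , d)
  Δ-vanishing-antidiagonal f a b c d ad≡0 cb≡0 rewrite ad≡0 | cb≡0 = identity (f (a , b) + f (c , d))
    where
    identity : ∀ x → x - (+ 0 + + 0) ≡ x
    identity = solve-∀

  0<-⇔< : ∀ a b → + 0 <ℤ a - b ⇔ b <ℤ a
  0<-⇔< a b = mk⇔
    (λ 0<a-b → subst₂ _<ℤ_ (ℤP.+-identityˡ b) (cancel a b) (ℤP.+-monoˡ-< b 0<a-b))
    (λ b<a → subst (_<ℤ a - b) (ℤP.+-inverseʳ b) (ℤP.+-monoˡ-< (- b) b<a))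
    where
    cancel : ∀ a b → (a - b) + b ≡ a
    cancel = solve-∀

  sum-to-one : ∀ a b c → + 0 ≤ℤ a → + 0 <ℤ b → + 0 ≤ℤ c → a + (b + c) ≡ + 1 → a ≡ + 0 × c ≡ + 0
  sum-to-one (+ zero) (+ suc b) (+ c) (+≤+ _) (+<+ _) (+≤+ _) sum≡1 =
    refl , cong +_ (ℕP.m+n≡0⇒n≡0 b (ℕP.suc-injective (ℤP.+-injective sum≡1)))
  sum-to-one (+ suc a) (+ suc b) (+ c) (+≤+ _) (+<+ _) (+≤+ _) sum≡1 =
    ⊥-elim (ℕP.m+1+n≢0 a (ℕP.suc-injective (ℤP.+-injective sum≡1)))

open MixedDifference
D-nonneg : ∀ {n} (v : Perm n) {a b c d} → a ≤ b → c ≤ d → + 0 ≤ℤ D v (a , c) (b , d)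
D-nonneg v a≤b c≤d = ℤP.i≤j⇒0≤j-i (+≤+ (rank-rectangle v a≤b c≤d))

D-nonneg-reversed : ∀ {n} (v : Perm n) {a b c d} → b ≤ a → d ≤ c → + 0 ≤ℤ D v (a , c) (b , d)
D-nonneg-reversed v {a} {b} {c} {d} b≤a d≤c =
  subst (+ 0 ≤ℤ_) (Δ-sym (rk v) (b , d) (a , c)) (D-nonneg v b≤a d≤c)

module PairRanks {n : ℕ} (τ : Pair n) where
  open import Data.Integer using (_+_)
  import Data.Integer as Int

  private
    w≤x : RankBelow (w τ) (x τ)
    w≤x = bruhat-rank (x≤w τ)

    rkτ-zero : ∀ {a b} → rkℕ (x τ) a b ≡ rkℕ (w τ) a b → rkτ τ (a , b) ≡ + 0
    rkτ-zero x≡w = ℤP.i≡j⇒i-j≡0 (cong +_ x≡w)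

  rkτ-nonneg : ∀ q → + 0 ≤ℤ rkτ τ q
  rkτ-nonneg (a , b) = ℤP.i≤j⇒0≤j-i (+≤+ (rank-≤ w≤x a b))

  rkτ-first-row : ∀ b → rkτ τ (0 , b) ≡ + 0
  rkτ-first-row b = rkτ-zero (trans (rank-row-zero (x τ) b) (sym (rank-row-zero (w τ) b)))

  rkτ-first-column : ∀ a → rkτ τ (a , 0) ≡ + 0
  rkτ-first-column a = rkτ-zero (trans (rank-column-zero (x τ) a) (sym (rank-column-zero (w τ) a)))

  rkτ-last-row : ∀ b → rkτ τ (n , b) ≡ + 0
  rkτ-last-row b = rkτ-zero (sym (last-row-≡ w≤x b))

  rkτ-last-column : ∀ a → rkτ τ (a , n) ≡ + 0
  rkτ-last-column a = rkτ-zero (rank-column-full (x τ) (w τ) a)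

  isX-sound : ∀ q → isX τ q ≡ true → rkτ τ q ≡ + 0
  isX-sound q = does-sound (rkτ τ q Int.≟ + 0)

  search-in-X : ∀ (pt : ℕ → Pt) {m d} → isX τ (pt m) ≡ true ⊎ m ≡ d → rkτ τ (pt d) ≡ + 0 →
    rkτ τ (pt m) ≡ + 0
  search-in-X pt {m} (inj₁ found) _ = isX-sound (pt m) found
  search-in-X pt (inj₂ refl) default∈X = default∈X

  D-split : ∀ q r → D (x τ) q r ≡ D (w τ) q r + Δ (rkτ τ) q r
  D-split = Δ-split (rk (x τ)) (rk (w τ))

open PairRanks

module Characterisation {n : ℕ} (τ : Pair n) (i j c : ℕ) (ic∈X : rkτ τ (i , c) ≡ + 0) where
  open import Data.Integer using (_+_; _-_)
  import Data.Integer as Int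

  p : Pt
  p = (i , j)

  Admissible : ℕ → Set
  Admissible l = rkτ τ (l , c) ≡ + 0 × D (w τ) p (l , c) ≡ + 0

  admissible? : ℕ → Bool
  admissible? l = isX τ (l , c) ∧ isZero (D (w τ) p (l , c))

  admissible-sound : ∀ l → admissible? l ≡ true → Admissible l
  admissible-sound l test with ∧-true {isX τ (l , c)} test
  ... | inX , Dw-zero = isX-sound τ (l , c) inX , does-sound (D (w τ) p (l , c) Int.≟ + 0) Dw-zero

  admissible-complete : ∀ {l} → Admissible l → admissible? l ≡ true
  admissible-complete {l} (inX , Dw-zero) =
    cong₂ _∧_ (dec-true (rkτ τ (l , c) Int.≟ + 0) inX) (dec-true (D (w τ) p (l , c) Int.≟ + 0) Dw-zero)

  Witness : ℕ → Set
  Witness l = InX τ (l , c) × D (w τ) p (l , c) ≡ + 0 × + 0 <ℤ D (x τ) p (l , c)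

  drop : ∀ {l} → Admissible l → D (x τ) p (l , c) ≡ rkτ τ p - rkτ τ (l , j)
  drop {l} (lc∈X , Dw≡0) = begin
    D (x τ) p (l , c)                           ≡⟨ D-split τ p (l , c) ⟩
    D (w τ) p (l , c) + Δ (rkτ τ) p (l , c)     ≡⟨ cong₂ _+_ Dw≡0 (Δ-vanishing-column (rkτ τ) i j l c ic∈X lc∈X) ⟩
    + 0 + (rkτ τ p - rkτ τ (l , j))             ≡⟨ ℤP.+-identityˡ _ ⟩
    rkτ τ p - rkτ τ (l , j)                     ∎
    where open ≡-Reasoning

  positive⇔drop : ∀ {l} → Admissible l → + 0 <ℤ D (x τ) p (l , c) ⇔ rkτ τ (l , j) <ℤ rkτ τ p
  positive⇔drop {l} adm = subst (λ d → + 0 <ℤ d ⇔ rkτ τ (l , j) <ℤ rkτ τ p) (sym (drop adm))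
    (0<-⇔< (rkτ τ p) (rkτ τ (l , j)))

  -- Between admissible rows l and l', rk_τ(· , j) decreases in the direction in which
  -- the rectangle has D_x ≥ 0: there D_w vanishes (it is a difference of two zeros).
  compare : ∀ {l l'} → Admissible l → Admissible l' → + 0 ≤ℤ D (x τ) (l , j) (l' , c) →
    rkτ τ (l' , j) ≤ℤ rkτ τ (l , j)
  compare {l} {l'} (lc∈X , Dw-l≡0) (l'c∈X , Dw-l'≡0) Dx≥0 = ℤP.0≤i-j⇒j≤i (subst (+ 0 ≤ℤ_) Dx≡drop Dx≥0)
    where
    open ≡-Reasoning
    Dw≡0 : D (w τ) (l , j) (l' , c) ≡ + 0
    Dw≡0 = sym (begin
      + 0                                        ≡⟨ Dw-l'≡0 ⟨
      D (w τ) p (l' , c)                         ≡⟨ Δ-rows (rk (w τ)) i l l' j c ⟩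
      D (w τ) p (l , c) + D (w τ) (l , j) (l' , c) ≡⟨ cong (_+ D (w τ) (l , j) (l' , c)) Dw-l≡0 ⟩
      + 0 + D (w τ) (l , j) (l' , c)             ≡⟨ ℤP.+-identityˡ _ ⟩
      D (w τ) (l , j) (l' , c)                   ∎)
    Dx≡drop : D (x τ) (l , j) (l' , c) ≡ rkτ τ (l , j) - rkτ τ (l' , j)
    Dx≡drop = begin
      D (x τ) (l , j) (l' , c)                                  ≡⟨ D-split τ (l , j) (l' , c) ⟩
      D (w τ) (l , j) (l' , c) + Δ (rkτ τ) (l , j) (l' , c)     ≡⟨ cong₂ _+_ Dw≡0 (Δ-vanishing-column (rkτ τ) l j l' c lc∈X l'c∈X) ⟩
      + 0 + (rkτ τ (l , j) - rkτ τ (l' , j))                    ≡⟨ ℤP.+-identityˡ _ ⟩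
      rkτ τ (l , j) - rkτ τ (l' , j)                            ∎

  -- A search selects the row I: the extreme admissible row
  -- on one side of i, or i itself if there is none.
  selection⇔ : (Side : ℕ → Set) (I : ℕ) → c ≤ n → I ≤ n →
    (Admissible I ⊎ I ≡ i) → (I ≢ i → Side I) →
    (∀ l → Side l → l ≤ n → Admissible l → I ≢ i × + 0 ≤ℤ D (x τ) (l , j) (I , c)) →
    rkτ τ (I , j) <ℤ rkτ τ p ⇔ Σ ℕ (λ l → Side l × Witness l)
  selection⇔ Side I c≤n I≤n selected side extreme = mk⇔ forward backward
    where
    admissible-if-moved : I ≢ i → Admissible I
    admissible-if-moved I≢i = [ (λ adm → adm) , (λ I≡i → ⊥-elim (I≢i I≡i)) ] selected

    forward : rkτ τ (I , j) <ℤ rkτ τ p → Σ ℕ (λ l → Side l × Witness l)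
    forward lowered = I , side I≢i , ((I≤n , c≤n) , proj₁ adm) , proj₂ adm , Equivalence.from (positive⇔drop adm) lowered
      where
      I≢i : I ≢ i
      I≢i I≡i = ℤP.<-irrefl (cong (λ l → rkτ τ (l , j)) I≡i) lowered
      adm = admissible-if-moved I≢i

    backward : Σ ℕ (λ l → Side l × Witness l) → rkτ τ (I , j) <ℤ rkτ τ p
    backward (l , l-side , ((l≤n , _) , lc∈X) , Dw≡0 , Dx>0) =
      ℤP.≤-<-trans (compare adm-l (admissible-if-moved I≢i) Dx≥0) (Equivalence.to (positive⇔drop adm-l) Dx>0)
      where
      adm-l : Admissible l
      adm-l = lc∈X , Dw≡0
      I≢i = proj₁ (extreme l l-side l≤n adm-l)
      Dx≥0 = proj₂ (extreme l l-side l≤n adm-l)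

  -- The witness produced by R→ and R←: if the anti-diagonal corners (i , c) and (l , j)
  -- lie in X_τ, then D_x(p , (l , c)) = D_w + rk_τ(p) + rk_τ(l , c) is a sum of
  -- non-negative terms with rk_τ(p) > 0, so D_x = 1 forces the other two to vanish.
  unit-witness : ∀ {l} → l ≤ n → c ≤ n → rkτ τ (l , j) ≡ + 0 → + 0 ≤ℤ D (w τ) p (l , c) →
    rkτ τ p ≢ + 0 → D (x τ) p (l , c) ≡ + 1 → Witness l
  unit-witness {l} l≤n c≤n lj∈X Dw≥0 p∉X Dx≡1 =
    ((l≤n , c≤n) , proj₂ vanish) , proj₁ vanish , subst (+ 0 <ℤ_) (sym Dx≡1) (+<+ (s≤s z≤n))
    where
    open ≡-Reasoning
    Dx≡sum : D (w τ) p (l , c) + (rkτ τ p + rkτ τ (l , c)) ≡ + 1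
    Dx≡sum = begin
      D (w τ) p (l , c) + (rkτ τ p + rkτ τ (l , c)) ≡⟨ cong (λ s → D (w τ) p (l , c) + s) (Δ-vanishing-antidiagonal (rkτ τ) i j l c ic∈X lj∈X) ⟨
      D (w τ) p (l , c) + Δ (rkτ τ) p (l , c)       ≡⟨ D-split τ p (l , c) ⟨
      D (x τ) p (l , c)                             ≡⟨ Dx≡1 ⟩
      + 1                                           ∎
    vanish = sum-to-one _ _ _ Dw≥0 (ℤP.≤∧≢⇒< (rkτ-nonneg τ p) (p∉X ∘ sym)) (rkτ-nonneg τ (l , c)) Dx≡sum

below-pred : ∀ {r} k → 1 ≤ k → r ≤ k ∸ 1 → r < k
below-pred (suc k) _ r≤k = s≤s r≤k

below-last : ∀ n k → 1 ≤ k → k ≤ n ∸ 1 → k < n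
below-last zero k 1≤k k≤0 = ⊥-elim (ℕP.<-irrefl refl (ℕP.<-≤-trans 1≤k k≤0))
below-last (suc n) k _ k≤n = s≤s k≤n

module Lemma42 {n : ℕ} (τ : Pair n) (i j : ℕ) (1≤i : 1 ≤ i) (i≤ : i ≤ n ∸ 1) (1≤j : 1 ≤ j) (j≤ : j ≤ n ∸ 1) where

  p : Pt
  p = (i , j)

  i<n : i < n
  i<n = below-last n i 1≤i i≤

  j<n : j < n
  j<n = below-last n j 1≤j j≤

  J : ℕ
  J = jPlus τ p

  j<J : j < J
  j<J = minUp-lower (λ k → isX τ (i , k)) (suc j) (n ∸ suc j)

  J≤n : J ≤ n
  J≤n = subst (J ≤_) (ℕP.m+[n∸m]≡n j<n) (minUp-upper (λ k → isX τ (i , k)) (suc j) (n ∸ suc j))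

  iJ∈X : rkτ τ (i , J) ≡ + 0
  iJ∈X = search-in-X τ (λ k → (i , k))
    (map₂ (λ e → trans e (ℕP.m+[n∸m]≡n j<n)) (minUp-found (λ k → isX τ (i , k)) (suc j) (n ∸ suc j)))
    (rkτ-last-column τ i)

  J' : ℕ
  J' = jMinus τ p

  J'≤j : J' ≤ j
  J'≤j = ℕP.≤-trans (maxDown-upper (λ k → isX τ (i , k)) 0 (j ∸ 1)) (ℕP.m∸n≤m j 1)

  iJ'∈X : rkτ τ (i , J') ≡ + 0
  iJ'∈X = search-in-X τ (λ k → (i , k)) (maxDown-found (λ k → isX τ (i , k)) 0 (j ∸ 1)) (rkτ-first-column τ i)

  module Right = Characterisation τ i j J iJ∈X
  module Left = Characterisation τ i j J' iJ'∈X

  I : ℕ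
  I = iPlus τ p

  i≤I : i ≤ I
  i≤I = maxDown-lower Right.admissible? i (n ∸ i)

  I≤n : I ≤ n
  I≤n = subst (I ≤_) (ℕP.m+[n∸m]≡n (ℕP.<⇒≤ i<n)) (maxDown-upper Right.admissible? i (n ∸ i))

  down⇔ : Pdown τ p ⇔ Σ ℕ (λ l → i < l × Right.Witness l)
  down⇔ = Right.selection⇔ (i <_) I J≤n I≤n
    (map₁ (Right.admissible-sound I) (maxDown-found Right.admissible? i (n ∸ i)))
    (λ I≢i → ℕP.≤∧≢⇒< i≤I (I≢i ∘ sym))
    extreme
    where
    extreme : ∀ l → i < l → l ≤ n → Right.Admissible l → I ≢ i × + 0 ≤ℤ D (x τ) (l , j) (I , J)
    extreme l i<l l≤n adm = (λ I≡i → ℕP.<⇒≱ i<l (subst (l ≤_) I≡i l≤I)) , D-nonneg (x τ) l≤I (ℕP.<⇒≤ j<J)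
      where
      l≤I : l ≤ I
      l≤I = maxDown-greatest Right.admissible? i (n ∸ i) l
              (subst (l ≤_) (sym (ℕP.m+[n∸m]≡n (ℕP.<⇒≤ i<n))) l≤n) (Right.admissible-complete adm)

  I' : ℕ
  I' = iMinus τ p

  I'≤i : I' ≤ i
  I'≤i = minUp-upper Left.admissible? 0 i

  up⇔ : Pup τ p ⇔ Σ ℕ (λ l → l < i × Left.Witness l)
  up⇔ = Left.selection⇔ (_< i) I' (ℕP.≤-trans J'≤j (ℕP.<⇒≤ j<n)) (ℕP.≤-trans I'≤i (ℕP.<⇒≤ i<n))
    (map₁ (Left.admissible-sound I') (minUp-found Left.admissible? 0 i))
    (ℕP.≤∧≢⇒< I'≤i)
    extreme
    where
    extreme : ∀ l → l < i → l ≤ n → Left.Admissible l → I' ≢ i × + 0 ≤ℤ D (x τ) (l , j) (I' , J')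
    extreme l l<i _ adm = (λ I'≡i → ℕP.<⇒≱ l<i (subst (_≤ l) I'≡i I'≤l)) , D-nonneg-reversed (x τ) I'≤l J'≤j
      where
      I'≤l : I' ≤ l
      I'≤l = minUp-least Left.admissible? 0 i l z≤n (Left.admissible-complete adm)

  -- R→(p) ⇒ P↓(p): p⁺ = (r , J) is a witness below p.
  right⇒down : rkτ τ p ≢ + 0 → Rright τ p → Pdown τ p
  right⇒down p∉X Dx≡1 = Equivalence.from down⇔ (r , i<r , Right.unit-witness r≤n J≤n rj∈X Dw≥0 p∉X Dx≡1)
    where
    r : ℕ
    r = proj₁ (plusPt τ p)
    i<r : i < r
    i<r = minUp-lower (λ l → isX τ (l , j)) (suc i) (n ∸ suc i)
    r≤n : r ≤ n
    r≤n = subst (r ≤_) (ℕP.m+[n∸m]≡n i<n) (minUp-upper (λ l → isX τ (l , j)) (suc i) (n ∸ suc i))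
    rj∈X : rkτ τ (r , j) ≡ + 0
    rj∈X = search-in-X τ (λ l → (l , j))
      (map₂ (λ e → trans e (ℕP.m+[n∸m]≡n i<n)) (minUp-found (λ l → isX τ (l , j)) (suc i) (n ∸ suc i)))
      (rkτ-last-row τ j)
    Dw≥0 : + 0 ≤ℤ D (w τ) p (r , J)
    Dw≥0 = D-nonneg (w τ) (ℕP.<⇒≤ i<r) (ℕP.<⇒≤ j<J)

  -- R←(p) ⇒ P↑(p): p⁻ = (r , J') is a witness above p.
  left⇒up : rkτ τ p ≢ + 0 → Rleft τ p → Pup τ p
  left⇒up p∉X Dx≡1 = Equivalence.from up⇔ (r , r<i , Left.unit-witness r≤n J'≤n rj∈X Dw≥0 p∉X Dx≡1)
    where
    r : ℕ
    r = proj₁ (minusPt τ p)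
    r<i : r < i
    r<i = below-pred i 1≤i (maxDown-upper (λ l → isX τ (l , j)) 0 (i ∸ 1))
    r≤n : r ≤ n
    r≤n = ℕP.≤-trans (ℕP.<⇒≤ r<i) (ℕP.<⇒≤ i<n)
    J'≤n : J' ≤ n
    J'≤n = ℕP.≤-trans J'≤j (ℕP.<⇒≤ j<n)
    rj∈X : rkτ τ (r , j) ≡ + 0
    rj∈X = search-in-X τ (λ l → (l , j)) (maxDown-found (λ l → isX τ (l , j)) 0 (i ∸ 1)) (rkτ-first-row τ j)
    Dw≥0 : + 0 ≤ℤ D (w τ) p (r , J')
    Dw≥0 = D-nonneg-reversed (w τ) (ℕP.<⇒≤ r<i) J'≤j

lemma4p2 : (n : ℕ) (τ : Pair n) (i j : ℕ) →
    1 ≤ i → i ≤ n ∸ 1 → 1 ≤ j → j ≤ n ∸ 1 →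
    (Pdown τ (i , j) ⇔
      Σ ℕ (λ i' → (i < i') × InX τ (i' , proj₂ (right τ (i , j)))
        × (D (w τ) (i , j) (i' , proj₂ (right τ (i , j))) ≡ + 0)
        × (+ 0 <ℤ D (x τ) (i , j) (i' , proj₂ (right τ (i , j))))))
    × (Pup τ (i , j) ⇔
      Σ ℕ (λ i' → (i' < i) × InX τ (i' , proj₂ (left τ (i , j)))
        × (D (w τ) (i , j) (i' , proj₂ (left τ (i , j))) ≡ + 0)
        × (+ 0 <ℤ D (x τ) (i , j) (i' , proj₂ (left τ (i , j))))))
    × (rkτ τ (i , j) ≢ + 0 →
        (Rright τ (i , j) → Pdown τ (i , j)) × (Rleft τ (i , j) → Pup τ (i , j)))
lemma4p2 n τ i j 1≤i i≤ 1≤j j≤ =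
  down⇔ , up⇔ , λ p∉X → right⇒down p∉X , left⇒up p∉X
  where open Lemma42 τ i j 1≤i i≤ 1≤j j≤
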